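{- For any connected cubic (3-regular) graph $G$, $\lambda(G)=\varphi(G)+2$. Furthermore, for any integer $r\ge 4$ and any connected $r$-regular graph $G$, $\lambda(G)\ge (r-2)\varphi(G)+2$.
   Context: For a spanning tree $T$ of a graph $G$, a vertex $v$ is of full degree in $T$ if $\deg_T(v)=\deg_G(v)$. $\varphi(G)$ denotes the maximum, over all spanning trees $T$ of $G$, of the number of vertices of full degree in $T$. $\lambda(G)$ denotes the maximum number of leaves in a spanning tree of $G$. -}

module Defs where

open import Data.Nat using (ℕ; zero; suc; _+_; _*_; _∸_; _≤_; _<_)
open import Data.Fin using (Fin)
open import Data.Bool using (Bool; true; false)
open import Data.List using (List; filter; length; allFin)
open import Data.Product using (Σ; _×_; ∃; ∃-syntax)
open import Relation.Binary.PropositionalEquality using (_≡_)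
open import Relation.Nullary using (¬_)
open import Data.Bool.Properties using (T?)
open import Data.Nat.Properties using (_≟_)

record Graph (n : ℕ) : Set where
  field
    adj  : Fin n → Fin n → Bool
    sym  : ∀ u v → adj u v ≡ adj v u
    irr  : ∀ v → adj v v ≡ false
open Graph public

deg : ∀ {n} → Graph n → Fin n → ℕ
deg G v = length (filter (λ u → T? (adj G v u)) (allFin _))

countV : ∀ {n} → (Fin n → ℕ) → ℕ → ℕ
countV {n} f k = length (filter (λ v → f v ≟ k) (allFin n))

Regular : ∀ {n} → ℕ → Graph n → Set
Regular r G = ∀ v → deg G v ≡ r

data Reach {n} (G : Graph n) : Fin n → Fin n → Set where
  here : ∀ {v} → Reach G v v
  step : ∀ {u w v} → adj G u w ≡ true → Reach G w v → Reach G u v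

Connected : ∀ {n} → Graph n → Set
Connected {n} G = (1 ≤ n) × (∀ u v → Reach G u v)

Cycle : ∀ {n} → Graph n → Set
Cycle {n} G =
  Σ ℕ λ m → Σ (ℕ → Fin n) λ c →
    (3 ≤ m)
    × (∀ i j → i < m → j < m → c i ≡ c j → i ≡ j)
    × (∀ i → suc i < m → adj G (c i) (c (suc i)) ≡ true)
    × (adj G (c (m ∸ 1)) (c 0) ≡ true)

Subgraph : ∀ {n} → Graph n → Graph n → Set
Subgraph T G = ∀ u v → adj T u v ≡ true → adj G u v ≡ true

SpanningTree : ∀ {n} → Graph n → Graph n → Set
SpanningTree T G = Subgraph T G × Connected T × ¬ Cycle T

leaves : ∀ {n} → Graph n → ℕ
leaves T = countV (deg T) 1

fullDeg : ∀ {n} → Graph n → Graph n → ℕ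
fullDeg {n} T G = length (filter (λ v → deg T v ≟ deg G v) (allFin n))

IsMaxOverSpanningTrees : ∀ {n} → Graph n → (Graph n → ℕ) → ℕ → Set
IsMaxOverSpanningTrees G f k =
  (∃[ T ] (SpanningTree T G × f T ≡ k)) × (∀ T → SpanningTree T G → f T ≤ k)

IsLambda : ∀ {n} → Graph n → ℕ → Set
IsLambda G k = IsMaxOverSpanningTrees G leaves k

IsPhi : ∀ {n} → Graph n → ℕ → Set
IsPhi G k = IsMaxOverSpanningTrees G (λ T → fullDeg T G) k

{-# OPTIONS --safe #-}
module Submission where

-- Every spanning tree T of a connected r-regular graph (r ≥ 1) has all degrees between 1 and r,
-- and Σᵥ (deg_T v + [deg_T v = 1]) = 2n − 2 + leaves T.  A vertex of T-degree d contributes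
-- d + [d = 1] ≥ 2 + (r − 2)·[d = r], with equality for r = 3, so summing gives
-- leaves T ≥ (r − 2)·fullDeg T + 2 for every spanning tree, with equality for cubic G;
-- taking maxima over spanning trees yields the theorem.  The degree sum 2n − 2 of a tree comes
-- from two inductions on vertex sets s, tracking twice the number of edges inside s: in a forest
-- s always contains a vertex with at most one neighbour in s (otherwise a walk in s that never
-- backtracks must revisit a vertex, and its first revisit closes a cycle), and a connected graph
-- can be exhausted by adding one neighbour of the current set at a time.

open import Defs hiding (sym)
open import Data.Nat using (ℕ; zero; suc; _+_; _*_; _∸_; _≤_; _<_; z≤n; s≤s)
open import Data.Nat.Properties
open import Data.Nat.Induction using (<-wellFounded)
open import Induction.WellFounded using (Acc; acc)
open import Data.Fin using (Fin; zero; suc; toℕ; fromℕ<)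
open import Data.Fin.Properties using (any?; pigeonhole; punchInᵢ≢i) renaming (_≟_ to _≟ᶠ_)
open import Data.Bool using (Bool; true; false; _∧_)
import Data.Bool.Properties as Bool
open import Data.List using (filter; length; tabulate)
open import Data.Vec.Functional using (removeAt; updateAt)
open import Data.Vec.Functional.Properties using (updateAt-updates; updateAt-minimal)
open import Data.Product using (_×_; _,_; proj₁; proj₂; ∃-syntax)
open import Data.Empty using (⊥; ⊥-elim)
open import Function using (_∘_)
open import Relation.Binary.PropositionalEquality
open import Relation.Binary.Definitions using (tri<; tri≈; tri>)
open import Relation.Nullary using (¬_; yes; no; does)
open import Relation.Nullary.Decidable using (_×-dec_; ¬?; dec-true; dec-false)
open import Relation.Unary using (Pred; Decidable)
open import Algebra.Properties.CommutativeMonoid.Sum +-0-commutativeMonoid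
  using (sum; sum-syntax; sum-cong-≗; ∑-distrib-+; sum-remove)
open import Algebra.Properties.Semiring.Sum +-*-semiring using (*-distribˡ-sum)

𝟙 : Bool → ℕ
𝟙 true  = 1
𝟙 false = 0

𝟙-∧ : ∀ a b → 𝟙 (a ∧ b) ≡ 𝟙 a * 𝟙 b
𝟙-∧ true  true  = refl
𝟙-∧ true  false = refl
𝟙-∧ false _     = refl

𝟙≤1 : ∀ b → 𝟙 b ≤ 1
𝟙≤1 true  = ≤-refl
𝟙≤1 false = z≤n

𝟙≡0⇒false : ∀ {b} → 𝟙 b ≡ 0 → b ≡ false
𝟙≡0⇒false {false} _ = refl

𝟙-mono : ∀ {a b} → (a ≡ true → b ≡ true) → 𝟙 a ≤ 𝟙 b
𝟙-mono {false} _   = z≤n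
𝟙-mono {true}  a⇒b rewrite a⇒b refl = ≤-refl

∑-mono-≤ : ∀ {n} {f g : Fin n → ℕ} → (∀ i → f i ≤ g i) → ∑[ i < n ] f i ≤ ∑[ i < n ] g i
∑-mono-≤ {zero}  f≤g = z≤n
∑-mono-≤ {suc n} f≤g = +-mono-≤ (f≤g zero) (∑-mono-≤ (f≤g ∘ suc))

∑-const : ∀ n c → ∑[ i < n ] c ≡ n * c
∑-const zero    c = refl
∑-const (suc n) c = cong (c +_) (∑-const n c)

∑-const-2 : ∀ n → ∑[ i < n ] 2 ≡ 2 * n
∑-const-2 n = trans (∑-const n 2) (*-comm n 2)

∑-zero : ∀ {n} {f : Fin n → ℕ} → (∀ i → f i ≡ 0) → ∑[ i < n ] f i ≡ 0
∑-zero {n} f≡0 = trans (sum-cong-≗ f≡0) (trans (∑-const n 0) (*-zeroʳ n))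

term≤∑ : ∀ {n} (f : Fin n → ℕ) i → f i ≤ ∑[ j < n ] f j
term≤∑ f zero    = m≤m+n (f zero) _
term≤∑ f (suc i) = ≤-trans (term≤∑ (f ∘ suc) i) (m≤n+m _ (f zero))

∑-isolate : ∀ {n} (f g : Fin n → ℕ) x → g x ≡ 0 → (∀ i → i ≢ x → f i ≡ g i) →
            ∑[ i < n ] f i ≡ f x + ∑[ i < n ] g i
∑-isolate {suc n} f g x gx≡0 f≗g = begin
  sum f                     ≡⟨ sum-remove {i = x} f ⟩
  f x + sum (removeAt f x)  ≡⟨ cong (f x +_) (sum-cong-≗ (λ i → f≗g _ (punchInᵢ≢i x i))) ⟩
  f x + sum (removeAt g x)  ≡⟨ cong (f x +_) g≡removeAt ⟨
  f x + sum g               ∎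
  where
  open ≡-Reasoning
  g≡removeAt : sum g ≡ sum (removeAt g x)
  g≡removeAt = trans (sum-remove {i = x} g) (cong (_+ sum (removeAt g x)) gx≡0)

∑-𝟙-witness : ∀ {n} (b : Fin n → Bool) → 0 < ∑[ i < n ] 𝟙 (b i) → ∃[ i ] b i ≡ true
∑-𝟙-witness {zero} b ()
∑-𝟙-witness {suc n} b pos with b zero in b₀
... | true  = zero , b₀
... | false with i , bᵢ ← ∑-𝟙-witness (b ∘ suc) pos = suc i , bᵢ

length-filter-tabulate : ∀ {a p} {A : Set a} {P : Pred A p} (P? : Decidable P) {n} (g : Fin n → A) →
                         length (filter P? (tabulate g)) ≡ ∑[ i < n ] 𝟙 (does (P? (g i)))
length-filter-tabulate P? {zero}  g = refl
length-filter-tabulate P? {suc n} g with does (P? (g zero))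
... | true  = cong suc (length-filter-tabulate P? (g ∘ suc))
... | false = length-filter-tabulate P? (g ∘ suc)

deg≡∑adj : ∀ {n} (G : Graph n) v → deg G v ≡ ∑[ u < n ] 𝟙 (adj G v u)
deg≡∑adj G v = length-filter-tabulate (λ u → Bool.T? (adj G v u)) (λ u → u)

least : ∀ {p} {P : Pred ℕ p} → Decidable P → ∀ {k} → P k → ∃[ j ] (P j × ∀ {i} → i < j → ¬ P i)
least {P = P} P? {k} Pk = go k (<-wellFounded k) Pk
  where
  go : ∀ k → Acc _<_ k → P k → ∃[ j ] (P j × ∀ {i} → i < j → ¬ P i)
  go k (acc smaller) Pk with anyUpTo? P? k
  ... | yes (j , j<k , Pj) = go j (smaller j<k) Pj
  ... | no  none           = k , Pk , λ i<k Pi → none (_ , i<k , Pi)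

no-self-loop : ∀ {n} (G : Graph n) {v} → adj G v v ≢ true
no-self-loop G {v} loop with () ← trans (sym loop) (irr G v)

size : ∀ {n} → (Fin n → Bool) → ℕ
size {n} s = ∑[ v < n ] 𝟙 (s v)

degIn : ∀ {n} → Graph n → (Fin n → Bool) → Fin n → ℕ
degIn {n} T s v = ∑[ u < n ] 𝟙 (s u ∧ adj T v u)

degSum : ∀ {n} → Graph n → (Fin n → Bool) → ℕ
degSum {n} T s = ∑[ v < n ] (𝟙 (s v) * degIn T s v)

size≡0⇒empty : ∀ {n} (s : Fin n → Bool) → size s ≡ 0 → ∀ v → s v ≡ false
size≡0⇒empty s size≡0 v = 𝟙≡0⇒false (n≤0⇒n≡0 (≤-trans (term≤∑ (𝟙 ∘ s) v) (≤-reflexive size≡0)))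

size-full : ∀ {n} (s : Fin n → Bool) → (∀ v → s v ≡ true) → size s ≡ n
size-full {n} s full = trans (sum-cong-≗ (cong 𝟙 ∘ full)) (trans (∑-const n 1) (*-identityʳ n))

record Deletion {n} (s s′ : Fin n → Bool) (x : Fin n) : Set where
  field
    x∈s   : s x ≡ true
    x∉s′  : s′ x ≡ false
    agree : ∀ v → v ≢ x → s v ≡ s′ v

set : ∀ {n} → (Fin n → Bool) → Fin n → Bool → Fin n → Bool
set s x b = updateAt s x (λ _ → b)

remove-deletion : ∀ {n} {s : Fin n → Bool} {x} → s x ≡ true → Deletion s (set s x false) x
remove-deletion {s = s} {x} x∈s = record
  { x∈s = x∈s ; x∉s′ = updateAt-updates x s ; agree = λ v v≢x → sym (updateAt-minimal v x s v≢x) }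

insert-deletion : ∀ {n} {s : Fin n → Bool} {x} → s x ≡ false → Deletion (set s x true) s x
insert-deletion {s = s} {x} x∉s = record
  { x∈s = updateAt-updates x s ; x∉s′ = x∉s ; agree = λ v v≢x → updateAt-minimal v x s v≢x }

module _ {n} {s s′ : Fin n → Bool} {x : Fin n} (del : Deletion s s′ x) where
  open Deletion del
  open ≡-Reasoning

  size-deletion : size s ≡ suc (size s′)
  size-deletion = begin
    size s              ≡⟨ ∑-isolate (𝟙 ∘ s) (𝟙 ∘ s′) x (cong 𝟙 x∉s′) (λ v v≢x → cong 𝟙 (agree v v≢x)) ⟩
    𝟙 (s x) + size s′   ≡⟨ cong (λ b → 𝟙 b + size s′) x∈s ⟩
    suc (size s′)       ∎

  module _ (T : Graph n) where

    degIn-deletion : ∀ v → degIn T s v ≡ 𝟙 (adj T v x) + degIn T s′ v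
    degIn-deletion v = begin
      degIn T s v                         ≡⟨ ∑-isolate _ _ x (cong (λ b → 𝟙 (b ∧ adj T v x)) x∉s′)
                                                      (λ u u≢x → cong (λ b → 𝟙 (b ∧ adj T v u)) (agree u u≢x)) ⟩
      𝟙 (s x ∧ adj T v x) + degIn T s′ v  ≡⟨ cong (λ b → 𝟙 (b ∧ adj T v x) + degIn T s′ v) x∈s ⟩
      𝟙 (adj T v x) + degIn T s′ v        ∎

    degIn-deleted : degIn T s x ≡ degIn T s′ x
    degIn-deleted = trans (degIn-deletion x) (cong (λ b → 𝟙 b + degIn T s′ x) (irr T x))

    degSum-deletion : degSum T s ≡ 2 * degIn T s′ x + degSum T s′
    degSum-deletion = begin
      degSum T s
        ≡⟨ sum-cong-≗ (λ v → trans (cong (𝟙 (s v) *_) (degIn-deletion v)) (*-distribˡ-+ (𝟙 (s v)) _ _)) ⟩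
      ∑[ v < n ] (𝟙 (s v) * 𝟙 (adj T v x) + 𝟙 (s v) * degIn T s′ v)
        ≡⟨ ∑-distrib-+ (λ v → 𝟙 (s v) * 𝟙 (adj T v x)) _ ⟩
      ∑[ v < n ] (𝟙 (s v) * 𝟙 (adj T v x)) + ∑[ v < n ] (𝟙 (s v) * degIn T s′ v)
        ≡⟨ cong₂ _+_ edges-to-x rest ⟩
      d + (d + degSum T s′)
        ≡⟨ sym (+-assoc d d _) ⟩
      d + d + degSum T s′
        ≡⟨ cong (λ t → d + t + degSum T s′) (sym (+-identityʳ d)) ⟩
      2 * d + degSum T s′ ∎
      where
      d = degIn T s′ x
      edges-to-x : ∑[ v < n ] (𝟙 (s v) * 𝟙 (adj T v x)) ≡ d
      edges-to-x = trans (sum-cong-≗ λ v → trans (sym (𝟙-∧ (s v) _))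
                                                 (cong (λ b → 𝟙 (s v ∧ b)) (Graph.sym T v x)))
                         degIn-deleted
      rest : ∑[ v < n ] (𝟙 (s v) * degIn T s′ v) ≡ d + degSum T s′
      rest = begin
        ∑[ v < n ] (𝟙 (s v) * degIn T s′ v)  ≡⟨ ∑-isolate _ _ x (cong (λ b → 𝟙 b * d) x∉s′)
                                                   (λ v v≢x → cong (λ b → 𝟙 b * degIn T s′ v) (agree v v≢x)) ⟩
        𝟙 (s x) * d + degSum T s′            ≡⟨ cong (λ b → 𝟙 b * d + degSum T s′) x∈s ⟩
        1 * d + degSum T s′                  ≡⟨ cong (_+ degSum T s′) (*-identityˡ d) ⟩
        d + degSum T s′                      ∎

module Forest {n} (T : Graph n) (acyclic : ¬ Cycle T) where

  module Branching (s : Fin n → Bool) (branching : ∀ x → s x ≡ true → 2 ≤ degIn T s x) where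

    onward : ∀ p c → s c ≡ true → ∃[ y ] (s y ≡ true × adj T c y ≡ true × y ≢ p)
    onward p c c∈s with any? (λ y → (s y Bool.≟ true) ×-dec (adj T c y Bool.≟ true) ×-dec ¬? (y ≟ᶠ p))
    ... | yes found = found
    ... | no  none  = ⊥-elim (<-irrefl refl (≤-trans (branching c c∈s) (≤-trans (≤-reflexive only-p) (𝟙≤1 _))))
      where
      off-p : ∀ y → y ≢ p → 𝟙 (s y ∧ adj T c y) ≡ 0
      off-p y y≢p with s y in y∈s | adj T c y in cy
      ... | true  | true  = ⊥-elim (none (y , y∈s , cy , y≢p))
      ... | true  | false = refl
      ... | false | _     = refl
      only-p : degIn T s c ≡ 𝟙 (s p ∧ adj T c p)
      only-p = trans (∑-isolate _ (λ _ → 0) p refl off-p)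
                     (trans (cong (_ +_) (∑-zero {n} (λ _ → refl))) (+-identityʳ _))

    record Position : Set where
      field
        previous current : Fin n
        current∈s        : s current ≡ true

    advance : Position → Position
    advance σ = record { previous = current ; current = proj₁ next ; current∈s = proj₁ (proj₂ next) }
      where
      open Position σ
      next = onward previous current current∈s

    module Walk (x₀ : Fin n) (x₀∈s : s x₀ ≡ true) where

      position : ℕ → Position
      position zero    = record { previous = x₀ ; current = x₀ ; current∈s = x₀∈s }
      position (suc i) = advance (position i)

      walk : ℕ → Fin n
      walk = Position.current ∘ position

      walk-adj : ∀ i → adj T (walk i) (walk (suc i)) ≡ true
      walk-adj i = proj₁ (proj₂ (proj₂ (onward previous current current∈s)))
        where open Position (position i)

      walk-non-backtracking : ∀ i → walk (suc (suc i)) ≢ walk i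
      walk-non-backtracking i = proj₂ (proj₂ (proj₂ (onward previous current current∈s)))
        where open Position (position (suc i))

      cycle-of-segment : ∀ i m → 3 ≤ m → walk i ≡ walk (i + m) →
                         (∀ {a b} → a < b → b < i + m → walk a ≢ walk b) → Cycle T
      cycle-of-segment i m@(suc m′) 3≤m closes distinct = m , cyc , 3≤m , injective , consecutive , closing
        where
        cyc : ℕ → Fin n
        cyc k = walk (i + k)
        injective : ∀ k k′ → k < m → k′ < m → cyc k ≡ cyc k′ → k ≡ k′
        injective k k′ k<m k′<m eq with <-cmp k k′
        ... | tri< k<k′ _ _ = ⊥-elim (distinct (+-monoʳ-< i k<k′) (+-monoʳ-< i k′<m) eq)
        ... | tri≈ _ k≡k′ _ = k≡k′
        ... | tri> _ _ k′<k = ⊥-elim (distinct (+-monoʳ-< i k′<k) (+-monoʳ-< i k<m) (sym eq))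
        consecutive : ∀ k → suc k < m → adj T (cyc k) (cyc (suc k)) ≡ true
        consecutive k _ = subst (λ j → adj T (cyc k) (walk j) ≡ true) (sym (+-suc i k)) (walk-adj (i + k))
        closing : adj T (cyc m′) (cyc 0) ≡ true
        closing = subst (λ w → adj T (cyc m′) w ≡ true) wraps (walk-adj (i + m′))
          where
          wraps : walk (suc (i + m′)) ≡ cyc 0
          wraps = trans (cong walk (sym (+-suc i m′))) (trans (sym closes) (cong walk (sym (+-identityʳ i))))

      first-repeat-impossible : ∀ i m → 1 ≤ m → walk i ≡ walk (i + m) →
                                (∀ {a b} → a < b → b < i + m → walk a ≢ walk b) → ⊥
      first-repeat-impossible i 0 () _ _
      first-repeat-impossible i 1 _ closes _ =
        no-self-loop T (subst (λ w → adj T (walk i) w ≡ true) (trans (cong walk (+-comm 1 i)) (sym closes))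
                              (walk-adj i))
      first-repeat-impossible i 2 _ closes _ =
        walk-non-backtracking i (trans (cong walk (+-comm 2 i)) (sym closes))
      first-repeat-impossible i m@(suc (suc (suc _))) _ closes distinct =
        acyclic (cycle-of-segment i m (s≤s (s≤s (s≤s z≤n))) closes distinct)

      Repeat : ℕ → Set
      Repeat j = ∃[ i ] (i < j × walk i ≡ walk j)

      repeat? : Decidable Repeat
      repeat? j = anyUpTo? (λ i → walk i ≟ᶠ walk j) j

      no-branching-walk : ⊥
      no-branching-walk
        with i₀ , j₀ , i₀<j₀ , same₀ ← pigeonhole (n<1+n n) (walk ∘ toℕ)
        with j , (i , i<j , same) , earliest ← least repeat? {toℕ j₀} (toℕ i₀ , i₀<j₀ , same₀)
        = first-repeat-impossible i (j ∸ i) (m<n⇒0<n∸m i<j)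
            (trans same (cong walk (sym i+[j∸i]≡j)))
            (λ a<b b<i+m same′ → earliest (subst (_ <_) i+[j∸i]≡j b<i+m) (_ , a<b , same′))
        where
        i+[j∸i]≡j : i + (j ∸ i) ≡ j
        i+[j∸i]≡j = m+[n∸m]≡n (<⇒≤ i<j)

  ∃-leaf : ∀ s x → s x ≡ true → ∃[ y ] (s y ≡ true × degIn T s y ≤ 1)
  ∃-leaf s x x∈s with any? (λ y → (s y Bool.≟ true) ×-dec (degIn T s y ≤? 1))
  ... | yes leaf    = leaf
  ... | no  no-leaf = ⊥-elim (Walk.no-branching-walk x x∈s)
    where open Branching s (λ y y∈s → ≰⇒> (λ y-leaf → no-leaf (y , y∈s , y-leaf)))

  degSum-forest : ∀ k s → size s ≡ suc k → degSum T s + 2 ≤ 2 * suc k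
  degSum-forest k s size≡1+k
    with x , x∈s ← ∑-𝟙-witness s (subst (0 <_) (sym size≡1+k) (s≤s z≤n))
    with y , y∈s , y-leaf ← ∃-leaf s x x∈s
    = subst (λ t → t + 2 ≤ 2 * suc k) (sym (degSum-deletion del T))
            (remaining k (suc-injective (trans (sym (size-deletion del)) size≡1+k)))
    where
    s′ = set s y false
    del = remove-deletion y∈s
    degIn-y≤1 : degIn T s′ y ≤ 1
    degIn-y≤1 = subst (_≤ 1) (degIn-deleted del T) y-leaf
    remaining : ∀ k → size s′ ≡ k → 2 * degIn T s′ y + degSum T s′ + 2 ≤ 2 * suc k
    remaining zero    size≡0 = ≤-reflexive (cong₂ (λ a b → 2 * a + b + 2) (∑-zero isolated) (∑-zero emptied))
      where
      isolated : ∀ u → 𝟙 (s′ u ∧ adj T y u) ≡ 0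
      isolated u = cong (λ b → 𝟙 (b ∧ adj T y u)) (size≡0⇒empty s′ size≡0 u)
      emptied : ∀ v → 𝟙 (s′ v) * degIn T s′ v ≡ 0
      emptied v = cong (λ b → 𝟙 b * degIn T s′ v) (size≡0⇒empty s′ size≡0 v)
    remaining (suc k) size≡1+k = begin
      2 * degIn T s′ y + degSum T s′ + 2  ≤⟨ +-monoˡ-≤ 2 (+-monoˡ-≤ (degSum T s′) (*-monoʳ-≤ 2 degIn-y≤1)) ⟩
      2 + degSum T s′ + 2                 ≡⟨ +-assoc 2 _ 2 ⟩
      2 + (degSum T s′ + 2)               ≤⟨ +-monoʳ-≤ 2 (degSum-forest k s′ size≡1+k) ⟩
      2 + 2 * suc k                       ≡⟨ *-suc 2 (suc k) ⟨
      2 * suc (suc k)                     ∎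
      where open ≤-Reasoning

crossing : ∀ {n} {T : Graph n} {u z} → Reach T u z → (s : Fin n → Bool) → s u ≡ true → s z ≡ false →
           ∃[ a ] ∃[ b ] (s a ≡ true × s b ≡ false × adj T a b ≡ true)
crossing here s u∈s u∉s with () ← trans (sym u∈s) u∉s
crossing {u = u} (step {w = w} uw w⇝z) s u∈s z∉s with s w in w∈s
... | true  = crossing w⇝z s w∈s z∉s
... | false = u , w , u∈s , w∈s , uw

degSum-connected : ∀ {n} (T : Graph n) → (∀ u v → Reach T u v) → Fin n →
                   ∀ k → suc k ≤ n → ∃[ s ] (size s ≡ suc k × 2 * suc k ≤ degSum T s + 2)
degSum-connected {n} T reach v₀ zero _ = s , size≡1 , m≤n+m 2 (degSum T s)
  where
  s = set (λ _ → false) v₀ true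
  size≡1 : size s ≡ 1
  size≡1 = trans (size-deletion (insert-deletion {s = λ _ → false} {v₀} refl))
                 (cong suc (∑-zero {n} (λ _ → refl)))
degSum-connected {n} T reach v₀ (suc k) 2+k≤n
  with s , size≡1+k , bound ← degSum-connected T reach v₀ k (≤-trans (n≤1+n _) 2+k≤n)
  with any? (λ z → s z Bool.≟ false)
... | no  nothing-outside = ⊥-elim (<-irrefl refl (≤-trans 2+k≤n (≤-reflexive (trans (sym n≡size) size≡1+k))))
  where
  n≡size : size s ≡ n
  n≡size = size-full s λ v → Bool.¬-not (λ v∉s → nothing-outside (v , v∉s))
... | yes (z , z∉s)
  with y , y∈s ← ∑-𝟙-witness s (subst (0 <_) (sym size≡1+k) (s≤s z≤n))
  with a , b , a∈s , b∉s , ab ← crossing (reach y z) s y∈s z∉s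
  = s⁺ , trans (size-deletion del) (cong suc size≡1+k) , grown
  where
  s⁺ = set s b true
  del = insert-deletion b∉s
  b-attached : 1 ≤ degIn T s b
  b-attached = ≤-trans (≤-reflexive (cong₂ (λ p q → 𝟙 (p ∧ q)) (sym a∈s) (trans (sym ab) (Graph.sym T a b))))
                       (term≤∑ (λ u → 𝟙 (s u ∧ adj T b u)) a)
  grown : 2 * suc (suc k) ≤ degSum T s⁺ + 2
  grown = begin
    2 * suc (suc k)               ≡⟨ *-suc 2 (suc k) ⟩
    2 + 2 * suc k                 ≤⟨ +-mono-≤ (*-monoʳ-≤ 2 b-attached) bound ⟩
    2 * degIn T s b + (degSum T s + 2) ≡⟨ +-assoc (2 * degIn T s b) _ 2 ⟨
    2 * degIn T s b + degSum T s + 2   ≡⟨ cong (_+ 2) (degSum-deletion del T) ⟨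
    degSum T s⁺ + 2               ∎
    where open ≤-Reasoning

degSum-full : ∀ {n} (T : Graph n) → degSum T (λ _ → true) ≡ ∑[ v < n ] deg T v
degSum-full T = sum-cong-≗ (λ v → trans (*-identityˡ _) (sym (deg≡∑adj T v)))

degSum≤degSum-full : ∀ {n} (T : Graph n) s → degSum T s ≤ degSum T (λ _ → true)
degSum≤degSum-full T s =
  ∑-mono-≤ λ v → *-mono-≤ (𝟙≤1 (s v)) (∑-mono-≤ λ u → 𝟙-mono (Bool.∧-conicalʳ (s u) _))

tree-degree-sum : ∀ {n} (T : Graph n) → Connected T → ¬ Cycle T → ∑[ v < n ] deg T v + 2 ≡ 2 * n
tree-degree-sum {n} T (1≤n , reach) acyclic = ≤-antisym upper lower
  where
  full : Fin n → Bool
  full _ = true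
  1+[n∸1]≡n : suc (n ∸ 1) ≡ n
  1+[n∸1]≡n = m+[n∸m]≡n 1≤n
  upper : ∑[ v < n ] deg T v + 2 ≤ 2 * n
  upper = subst₂ (λ a b → a + 2 ≤ 2 * b) (degSum-full T) 1+[n∸1]≡n
            (Forest.degSum-forest T acyclic (n ∸ 1) full
              (trans (size-full full (λ _ → refl)) (sym 1+[n∸1]≡n)))
  lower : 2 * n ≤ ∑[ v < n ] deg T v + 2
  lower with s , _ , bound ← degSum-connected T reach (fromℕ< 1≤n) (n ∸ 1) (≤-reflexive 1+[n∸1]≡n)
    = subst₂ (λ a b → 2 * a ≤ b + 2) 1+[n∸1]≡n (degSum-full T)
             (≤-trans bound (+-monoˡ-≤ 2 (degSum≤degSum-full T s)))

leaves≡∑ : ∀ {n} (T : Graph n) → leaves T ≡ ∑[ v < n ] 𝟙 (does (deg T v ≟ 1))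
leaves≡∑ T = length-filter-tabulate (λ v → deg T v ≟ 1) (λ v → v)

fullDeg≡∑ : ∀ {n} (T G : Graph n) → fullDeg T G ≡ ∑[ v < n ] 𝟙 (does (deg T v ≟ deg G v))
fullDeg≡∑ T G = length-filter-tabulate (λ v → deg T v ≟ deg G v) (λ v → v)

tree-leaves : ∀ {n} (T : Graph n) → Connected T → ¬ Cycle T →
              ∑[ v < n ] (deg T v + 𝟙 (does (deg T v ≟ 1))) + 2 ≡ 2 * n + leaves T
tree-leaves {n} T connected acyclic = begin
  ∑[ v < n ] (deg T v + 𝟙 (does (deg T v ≟ 1))) + 2  ≡⟨ cong (_+ 2) (∑-distrib-+ (deg T) _) ⟩
  D + ∑[ v < n ] 𝟙 (does (deg T v ≟ 1)) + 2          ≡⟨ cong (λ l → D + l + 2) (leaves≡∑ T) ⟨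
  D + leaves T + 2                                   ≡⟨ +-assoc D (leaves T) 2 ⟩
  D + (leaves T + 2)                                 ≡⟨ cong (D +_) (+-comm (leaves T) 2) ⟩
  D + (2 + leaves T)                                 ≡⟨ +-assoc D 2 (leaves T) ⟨
  D + 2 + leaves T                                   ≡⟨ cong (_+ leaves T) (tree-degree-sum T connected acyclic) ⟩
  2 * n + leaves T                                   ∎
  where
  open ≡-Reasoning
  D = ∑[ v < n ] deg T v

deg-mono : ∀ {n} (T G : Graph n) → Subgraph T G → ∀ v → deg T v ≤ deg G v
deg-mono T G T⊆G v =
  subst₂ _≤_ (sym (deg≡∑adj T v)) (sym (deg≡∑adj G v)) (∑-mono-≤ (λ u → 𝟙-mono (T⊆G v u)))

deg-pos : ∀ {n} (T : Graph n) → (∀ u v → Reach T u v) → ∀ {u v} → u ≢ v → 1 ≤ deg T v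
deg-pos T reach {u} {v} u≢v with reach v u
... | here            = ⊥-elim (u≢v refl)
... | step {w = w} vw _ =
  subst (1 ≤_) (sym (deg≡∑adj T v)) (≤-trans (≤-reflexive (cong 𝟙 (sym vw))) (term≤∑ (𝟙 ∘ adj T v) w))

spanningTree-deg-bounds : ∀ {n r} (G T : Graph n) → 1 ≤ r → Regular r G → SpanningTree T G →
                          ∀ v → 1 ≤ deg T v × deg T v ≤ r
spanningTree-deg-bounds G T 1≤r regular (T⊆G , (_ , reach) , _) v
  with u , vu ← ∑-𝟙-witness (adj G v) (subst (0 <_) (trans (sym (regular v)) (deg≡∑adj G v)) 1≤r)
  = deg-pos T reach {u} {v} (λ { refl → no-self-loop G vu })
  , subst (deg T v ≤_) (regular v) (deg-mono T G T⊆G v)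

cubic-degree : ∀ d → 1 ≤ d → d ≤ 3 → d + 𝟙 (does (d ≟ 1)) ≡ 2 + 𝟙 (does (d ≟ 3))
cubic-degree 1 _ _ = refl
cubic-degree 2 _ _ = refl
cubic-degree 3 _ _ = refl
cubic-degree (suc (suc (suc (suc _)))) _ (s≤s (s≤s (s≤s ())))

regular-degree : ∀ r d → 2 ≤ r → 1 ≤ d → d ≤ r → 2 + (r ∸ 2) * 𝟙 (does (d ≟ r)) ≤ d + 𝟙 (does (d ≟ 1))
regular-degree r d 2≤r 1≤d d≤r with d ≟ r
... | yes refl rewrite dec-true (d ≟ d) refl =
  ≤-trans (≤-reflexive (trans (cong (2 +_) (*-identityʳ (d ∸ 2))) (m+[n∸m]≡n 2≤r))) (m≤m+n d _)
... | no  d≢r  rewrite dec-false (d ≟ r) d≢r =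
  ≤-trans (≤-reflexive (cong (2 +_) (*-zeroʳ (r ∸ 2)))) (nonleaf-or-leaf d 1≤d)
  where
  nonleaf-or-leaf : ∀ d → 1 ≤ d → 2 ≤ d + 𝟙 (does (d ≟ 1))
  nonleaf-or-leaf 1             _ = ≤-refl
  nonleaf-or-leaf (suc (suc _)) _ = s≤s (s≤s z≤n)

cubic-leaves : ∀ {n} (G T : Graph n) → Regular 3 G → SpanningTree T G → leaves T ≡ fullDeg T G + 2
cubic-leaves {n} G T cubic tree@(_ , connected , acyclic) = +-cancelˡ-≡ (2 * n) _ _ (begin
  2 * n + leaves T                                         ≡⟨ tree-leaves T connected acyclic ⟨
  ∑[ v < n ] (deg T v + 𝟙 (does (deg T v ≟ 1))) + 2         ≡⟨ cong (_+ 2) (sum-cong-≗ local) ⟩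
  ∑[ v < n ] (2 + 𝟙 (does (deg T v ≟ deg G v))) + 2         ≡⟨ cong (_+ 2) (∑-distrib-+ {n} (λ _ → 2) _) ⟩
  ∑[ v < n ] 2 + ∑[ v < n ] 𝟙 (does (deg T v ≟ deg G v)) + 2
    ≡⟨ cong₂ (λ a b → a + b + 2) (∑-const-2 n) (sym (fullDeg≡∑ T G)) ⟩
  2 * n + fullDeg T G + 2                                  ≡⟨ +-assoc (2 * n) _ 2 ⟩
  2 * n + (fullDeg T G + 2)                                ∎)
  where
  open ≡-Reasoning
  local : ∀ v → deg T v + 𝟙 (does (deg T v ≟ 1)) ≡ 2 + 𝟙 (does (deg T v ≟ deg G v))
  local v with 1≤d , d≤3 ← spanningTree-deg-bounds G T (s≤s z≤n) cubic tree v
    = trans (cubic-degree (deg T v) 1≤d d≤3) (cong (λ t → 2 + 𝟙 (does (deg T v ≟ t))) (sym (cubic v)))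

regular-leaves : ∀ {n r} (G T : Graph n) → 2 ≤ r → Regular r G → SpanningTree T G →
                 (r ∸ 2) * fullDeg T G + 2 ≤ leaves T
regular-leaves {n} {r} G T 2≤r regular tree@(_ , connected , acyclic) = +-cancelˡ-≤ (2 * n) _ _ (begin
  2 * n + ((r ∸ 2) * fullDeg T G + 2)                      ≡⟨ +-assoc (2 * n) _ 2 ⟨
  2 * n + (r ∸ 2) * fullDeg T G + 2
    ≡⟨ cong₂ (λ a b → a + b + 2) (sym (∑-const-2 n))
             (trans (cong ((r ∸ 2) *_) (fullDeg≡∑ T G)) (*-distribˡ-sum {n} (r ∸ 2) _)) ⟩
  ∑[ v < n ] 2 + ∑[ v < n ] ((r ∸ 2) * 𝟙 (does (deg T v ≟ deg G v))) + 2
    ≡⟨ cong (_+ 2) (∑-distrib-+ {n} (λ _ → 2) _) ⟨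
  ∑[ v < n ] (2 + (r ∸ 2) * 𝟙 (does (deg T v ≟ deg G v))) + 2
    ≤⟨ +-monoˡ-≤ 2 (∑-mono-≤ local) ⟩
  ∑[ v < n ] (deg T v + 𝟙 (does (deg T v ≟ 1))) + 2         ≡⟨ tree-leaves T connected acyclic ⟩
  2 * n + leaves T                                         ∎)
  where
  open ≤-Reasoning
  local : ∀ v → 2 + (r ∸ 2) * 𝟙 (does (deg T v ≟ deg G v)) ≤ deg T v + 𝟙 (does (deg T v ≟ 1))
  local v with 1≤d , d≤r ← spanningTree-deg-bounds G T (≤-trans (s≤s z≤n) 2≤r) regular tree v
    = subst (λ t → 2 + (r ∸ 2) * 𝟙 (does (deg T v ≟ t)) ≤ _) (sym (regular v))
            (regular-degree r (deg T v) 2≤r 1≤d d≤r)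

proposition2 :
    (∀ (n : ℕ) (G : Graph n) → Connected G → Regular 3 G →
       ∀ l f → IsLambda G l → IsPhi G f → l ≡ f + 2)
    × (∀ (r n : ℕ) (G : Graph n) → 4 ≤ r → Connected G → Regular r G →
       ∀ l f → IsLambda G l → IsPhi G f → (r ∸ 2) * f + 2 ≤ l)
proposition2 = cubic , regular
  where
  cubic : ∀ (n : ℕ) (G : Graph n) → Connected G → Regular 3 G →
          ∀ l f → IsLambda G l → IsPhi G f → l ≡ f + 2
  cubic n G _ 3-regular l f ((Tλ , treeλ , refl) , λ-max) ((Tφ , treeφ , refl) , φ-max) =
    ≤-antisym (≤-trans (≤-reflexive (cubic-leaves G Tλ 3-regular treeλ)) (+-monoˡ-≤ 2 (φ-max Tλ treeλ)))
              (≤-trans (≤-reflexive (sym (cubic-leaves G Tφ 3-regular treeφ))) (λ-max Tφ treeφ))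
  regular : ∀ (r n : ℕ) (G : Graph n) → 4 ≤ r → Connected G → Regular r G →
            ∀ l f → IsLambda G l → IsPhi G f → (r ∸ 2) * f + 2 ≤ l
  regular r n G 4≤r _ r-regular l f (_ , λ-max) ((T , tree , refl) , _) =
    ≤-trans (regular-leaves G T (≤-trans (s≤s (s≤s z≤n)) 4≤r) r-regular tree) (λ-max T tree)
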